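{- For every positive integer $n$ and every integer $k\ge2$ there exists a divisor $d\mid n$ with $d\le n^{1/k}$ and $\tau(n)\le 2^{k^2}\tau(d)^{k^3}$.
   Context: $\tau$ denotes the number-of-divisors function. -}

module Defs where

open import Data.Nat using (ℕ; suc)
open import Data.Nat.Divisibility using (_∣?_)
open import Data.List using (List; length; filter)
open import Data.List using (upTo)

τ : ℕ → ℕ
τ n = length (filter (λ d → d ∣? n) (Data.List.map suc (upTo n)))

-- Write n = p ^ e * m with p the least prime factor of n and p ∤ m, and obtain d from a
-- divisor already chosen for m. If e ≥ k, the power p ^ b with b = ⌊e/k⌋ joins d: the factor
-- 1 + e ≤ k (1 + b) ≤ (1 + b) ^ k² lost in τ is recovered from τ (d p^b) ≥ (1 + b) τ d.
-- If e < k, p is set aside instead, costing a factor k in τ. Once k − 1 primes have been set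
-- aside, all of them factors of m and hence at least p, p joins d: then p ^ k is at most p
-- times their product, so d ^ k ≤ n survives, and the accumulated factor k ^ k ≤ 2 ^ k² is
-- recovered from τ (d p) ≥ 2 τ d.

module Submission where

open import Defs
open import Data.Nat
open import Data.Nat.Properties
open import Data.Nat.Divisibility
open import Data.Nat.GCD
  using (gcd; gcd[m,n]∣m; gcd[m,n]∣n; gcd[m,n]≢0; gcd-greatest; c*gcd[m,n]≡gcd[cm,cn])
open import Data.Nat.Coprimality using (Coprime; coprime-divisor)
open import Data.Nat.Primality
  using ( Prime; _Rough_; prime⇒irreducible; prime⇒nonZero; prime⇒nonTrivial
        ; rough∧∣⇒prime; rough∧∣⇒rough; rough⇒≤; ∤⇒rough-suc; 1-rough; 2-rough)
open import Data.Nat.Induction using (<-rec)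
open import Data.Nat.DivMod using (_/_; _%_; m/n*n≤m; m%n<n; m≡m%n+[m/n]*n; m≥n⇒m/n>0)
open import Algebra.Properties.CommutativeSemigroup *-commutativeSemigroup
  using (interchange; x∙yz≈y∙xz; x∙yz≈y∙zx; xy∙z≈zx∙y; xy∙z≈xz∙y)
open import Data.List using (List; []; _∷_; _++_; length; filter; map; upTo; cartesianProduct)
open import Data.List.Properties using (length-map; length-++; length-upTo; length-removeAt′)
open import Data.List.Membership.Propositional using (_∈_)
open import Data.List.Membership.Propositional.Properties
  using ( ∈-filter⁺; ∈-filter⁻; ∈-map⁺; ∈-upTo⁺; ∈-upTo⁻
        ; ∈-cartesianProduct⁺; ∈-cartesianProduct⁻; ∈-length)
open import Data.List.Relation.Unary.Any using (here; there; index; _─_)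
open import Data.List.Relation.Unary.All as All using ()
open import Data.List.Relation.Unary.AllPairs using (_∷_)
open import Data.List.Relation.Unary.Unique.Propositional using (Unique)
import Data.List.Relation.Unary.Unique.Propositional.Properties as Unique
open import Data.Product using (∃-syntax; ∃₂; _×_; _,_; proj₁; proj₂; map₁; map₂)
open import Data.Sum using (inj₁; inj₂)
open import Relation.Binary.PropositionalEquality
open import Relation.Nullary using (yes; no; contradiction)
open import Function using (id; it; _∘_)

private
  variable
    A B : Set
    x y : A
    xs ys : List A
    n : ℕ

∈-─ : (x∈xs : x ∈ xs) → y ∈ xs → y ≢ x → y ∈ (xs ─ x∈xs)
∈-─ (here refl) (here refl)  y≢x = contradiction refl y≢x
∈-─ (here refl) (there y∈xs) _   = y∈xs
∈-─ (there _)   (here refl)  _   = here refl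
∈-─ (there x∈xs) (there y∈xs) y≢x = there (∈-─ x∈xs y∈xs y≢x)

injection⇒length-≤ : (f : A → B) → Unique xs →
                     (∀ {a b} → a ∈ xs → b ∈ xs → f a ≡ f b → a ≡ b) →
                     (∀ {a} → a ∈ xs → f a ∈ ys) → length xs ≤ length ys
injection⇒length-≤ {xs = []}     f _ _ _ = z≤n
injection⇒length-≤ {xs = x ∷ xs} {ys = ys} f (x∉xs ∷ xs!) inj f∈ys = begin
  suc (length xs)           ≤⟨ s≤s (injection⇒length-≤ f xs! (λ a∈ → inj (there a∈) ∘ there) f∈ys─fx) ⟩
  suc (length (ys ─ fx∈ys)) ≡⟨ length-removeAt′ ys (index fx∈ys) ⟨
  length ys                 ∎
  where
  open ≤-Reasoning
  fx∈ys = f∈ys (here refl)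
  f∈ys─fx : ∀ {a} → a ∈ xs → f a ∈ (ys ─ fx∈ys)
  f∈ys─fx a∈xs = ∈-─ fx∈ys (f∈ys (there a∈xs))
    (λ fa≡fx → All.lookup x∉xs a∈xs (sym (inj (there a∈xs) (here refl) fa≡fx)))

length-cartesianProduct : (xs : List A) (ys : List B) →
                          length (cartesianProduct xs ys) ≡ length xs * length ys
length-cartesianProduct []       ys = refl
length-cartesianProduct (x ∷ xs) ys = begin
  length (map (x ,_) ys ++ cartesianProduct xs ys)  ≡⟨ length-++ (map (x ,_) ys) ⟩
  length (map (x ,_) ys) + length (cartesianProduct xs ys)
    ≡⟨ cong₂ _+_ (length-map (x ,_) ys) (length-cartesianProduct xs ys) ⟩
  length ys + length xs * length ys ∎
  where open ≡-Reasoning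

^-distribʳ-* : ∀ m n o → (m * n) ^ o ≡ m ^ o * n ^ o
^-distribʳ-* m n zero    = refl
^-distribʳ-* m n (suc o) = begin
  m * n * (m * n) ^ o      ≡⟨ cong (m * n *_) (^-distribʳ-* m n o) ⟩
  m * n * (m ^ o * n ^ o)  ≡⟨ interchange m n (m ^ o) (n ^ o) ⟩
  m * m ^ o * (n * n ^ o)  ∎
  where open ≡-Reasoning

n<2^n : ∀ n → n < 2 ^ n
n<2^n zero    = z<s
n<2^n (suc n) = +-mono-≤ (m^n>0 2 n) (≤-trans (n<2^n n) (m≤m+n (2 ^ n) 0))

n^n≤2^[n*n] : ∀ n → n ^ n ≤ 2 ^ (n * n)
n^n≤2^[n*n] n = begin
  n ^ n        ≤⟨ ^-monoˡ-≤ n (<⇒≤ (n<2^n n)) ⟩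
  (2 ^ n) ^ n  ≡⟨ ^-*-assoc 2 n n ⟩
  2 ^ (n * n)  ∎
  where open ≤-Reasoning

m*n≤n^[m*m] : ∀ {m n} → 2 ≤ m → 2 ≤ n → m * n ≤ n ^ (m * m)
m*n≤n^[m*m] {m} {n} 2≤m 2≤n = begin
  m * n        ≤⟨ *-monoˡ-≤ n m≤n^m ⟩
  n ^ m * n    ≡⟨ *-comm (n ^ m) n ⟩
  n ^ suc m    ≤⟨ ^-monoʳ-≤ n 1+m≤m*m ⟩
  n ^ (m * m)  ∎
  where
  open ≤-Reasoning
  instance _ = >-nonZero (≤-trans (s≤s z≤n) 2≤n)
  m≤n^m : m ≤ n ^ m
  m≤n^m = ≤-trans (<⇒≤ (n<2^n m)) (^-monoˡ-≤ m 2≤n)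
  1+m≤m*m : suc m ≤ m * m
  1+m≤m*m = ≤-trans (+-mono-≤ (≤-trans (s≤s z≤n) 2≤m) (m≤m+n m 0)) (*-monoˡ-≤ m 2≤m)

suc[m]≤suc[m/n]*n : ∀ m n .{{_ : NonZero n}} → suc m ≤ suc (m / n) * n
suc[m]≤suc[m/n]*n m n = begin
  suc m                  ≡⟨ cong suc (m≡m%n+[m/n]*n m n) ⟩
  suc (m % n) + m / n * n ≤⟨ +-monoˡ-≤ (m / n * n) (m%n<n m n) ⟩
  n + m / n * n          ∎
  where open ≤-Reasoning

^-monoʳ-∣ : ∀ m {n o} → n ≤ o → m ^ n ∣ m ^ o
^-monoʳ-∣ m {n} {o} n≤o = subst (m ^ n ∣_) m^n*m^[o∸n]≡m^o (m∣m*n (m ^ (o ∸ n)))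
  where
  m^n*m^[o∸n]≡m^o : m ^ n * m ^ (o ∸ n) ≡ m ^ o
  m^n*m^[o∸n]≡m^o = trans (sym (^-distribˡ-+-* m n (o ∸ n))) (cong (m ^_) (m+[n∸m]≡n n≤o))

∣⇒nonZero : ∀ {m} .{{_ : NonZero n}} → m ∣ n → NonZero m
∣⇒nonZero {n} {m = zero}  0∣n = contradiction (0∣⇒≡0 0∣n) (≢-nonZero⁻¹ n)
∣⇒nonZero {n} {m = suc _} _   = _

prime∧∤⇒coprime : ∀ {m p} → Prime p → p ∤ m → Coprime m p
prime∧∤⇒coprime pr p∤m (d∣m , d∣p) with prime⇒irreducible pr d∣p
... | inj₁ d≡1  = d≡1
... | inj₂ refl = contradiction d∣m p∤m

∣p^n⇒≡p^i : ∀ {m p} → Prime p → ∀ n → m ∣ p ^ n → ∃[ i ] (i ≤ n × m ≡ p ^ i)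
∣p^n⇒≡p^i pr zero m∣1 = 0 , z≤n , ∣1⇒≡1 m∣1
∣p^n⇒≡p^i {m} {p} pr (suc n) m∣p^[1+n] with p ∣? m
... | no p∤m = map₂ (map₁ m≤n⇒m≤1+n)
  (∣p^n⇒≡p^i pr n (coprime-divisor (prime∧∤⇒coprime pr p∤m) m∣p^[1+n]))
... | yes (divides q refl)
  with i , i≤n , refl ← ∣p^n⇒≡p^i pr n
         (*-cancelʳ-∣ {q} p {{prime⇒nonZero pr}} (subst (q * p ∣_) (*-comm p (p ^ n)) m∣p^[1+n]))
  = suc i , s≤s i≤n , *-comm (p ^ i) p

p∣m*p^[1+n] : ∀ {p} m n → p ∣ m * p ^ suc n
p∣m*p^[1+n] {p} m n = ∣-trans (m∣m*n (p ^ n)) (n∣m*n m)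

*p^-injective : ∀ {p m m′} i j .{{_ : NonZero p}} → p ∤ m → p ∤ m′ →
                m * p ^ i ≡ m′ * p ^ j → m ≡ m′ × i ≡ j
*p^-injective {p} {m} {m′} zero zero _ _ eq =
  *-cancelʳ-≡ m m′ 1 eq , refl
*p^-injective {p} {m} {m′} zero (suc j) p∤m _ eq =
  contradiction (subst (p ∣_) (trans (sym eq) (*-identityʳ m)) (p∣m*p^[1+n] m′ j)) p∤m
*p^-injective {p} {m} {m′} (suc i) zero _ p∤m′ eq =
  contradiction (subst (p ∣_) (trans eq (*-identityʳ m′)) (p∣m*p^[1+n] m i)) p∤m′
*p^-injective {p} {m} {m′} (suc i) (suc j) p∤m p∤m′ eq =
  map₂ (cong suc) (*p^-injective i j p∤m p∤m′ (*-cancelˡ-≡ _ _ p p*m*p^i≡p*m′*p^j))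
  where
  open ≡-Reasoning
  p*m*p^i≡p*m′*p^j : p * (m * p ^ i) ≡ p * (m′ * p ^ j)
  p*m*p^i≡p*m′*p^j = begin
    p * (m * p ^ i)   ≡⟨ x∙yz≈y∙xz p m (p ^ i) ⟩
    m * (p * p ^ i)   ≡⟨ eq ⟩
    m′ * (p * p ^ j)  ≡⟨ x∙yz≈y∙xz m′ p (p ^ j) ⟩
    p * (m′ * p ^ j)  ∎

factorOut : ∀ p .{{_ : NonTrivial p}} n .{{_ : NonZero n}} → ∃₂ λ e m → n ≡ p ^ e * m × p ∤ m
factorOut p = <-rec _ factorOut′
  where
  Goal : ℕ → Set
  Goal n = .{{NonZero n}} → ∃₂ λ e m → n ≡ p ^ e * m × p ∤ m
  factorOut′ : ∀ n → (∀ {q} → q < n → Goal q) → Goal n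
  factorOut′ n rec with p ∣? n
  ... | no p∤n = 0 , n , sym (+-identityʳ n) , p∤n
  ... | yes p∣n@(divides q refl)
    with e , m , q≡p^e*m , p∤m ← rec (quotient-< p∣n) {{quotient≢0 p∣n}} =
    suc e , m , trans (cong (_* p) q≡p^e*m) (xy∙z≈zx∙y (p ^ e) m p) , p∤m

leastPrimeFactor : ∀ n .{{_ : NonTrivial n}} → ∃[ p ] (Prime p × p ∣ n × p Rough n)
leastPrimeFactor n@(2+ n-2) = search n-2 0 (+-comm n-2 2) 2-rough
  where
  search : ∀ k i → k + (2 + i) ≡ n → (2 + i) Rough n → ∃[ p ] (Prime p × p ∣ n × p Rough n)
  search zero    i eq rough = 2 + i , rough∧∣⇒prime rough p∣n , p∣n , rough
    where p∣n = subst (2 + i ∣_) eq ∣-refl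
  search (suc k) i eq rough with 2 + i ∣? n
  ... | yes p∣n = 2 + i , rough∧∣⇒prime rough p∣n , p∣n , rough
  ... | no  p∤n = search k (suc i) (trans (+-suc k (2 + i)) eq) (∤⇒rough-suc p∤n rough)

record LeastPrimeSplit (n : ℕ) : Set where
  field
    p a m       : ℕ
    p-prime     : Prime p
    p-rough     : p Rough n
    p∤m         : p ∤ m
    n≡p^[1+a]*m : n ≡ p ^ suc a * m

  instance
    p≢0 : NonZero p
    p≢0 = prime⇒nonZero p-prime
    p>1 : NonTrivial p
    p>1 = prime⇒nonTrivial p-prime

  p∣n : p ∣ n
  p∣n = subst (p ∣_) (sym n≡p^[1+a]*m) (∣-trans (m∣m*n (p ^ a)) (m∣m*n m))

  m∣n : m ∣ n
  m∣n = divides (p ^ suc a) n≡p^[1+a]*m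

  m≢0 : .{{NonZero n}} → NonZero m
  m≢0 = m*n≢0⇒n≢0 (p ^ suc a) {{subst NonZero n≡p^[1+a]*m it}}

  m<n : .{{NonZero n}} → m < n
  m<n = begin-strict
    m              <⟨ m<m*n m (p ^ suc a) {{m≢0}} (^-monoʳ-< p (nonTrivial⇒n>1 p) {0} {suc a} z<s) ⟩
    m * p ^ suc a  ≡⟨ *-comm m (p ^ suc a) ⟩
    p ^ suc a * m  ≡⟨ n≡p^[1+a]*m ⟨
    n              ∎
    where open ≤-Reasoning

leastPrimeSplit : ∀ n .{{_ : NonTrivial n}} → LeastPrimeSplit n
leastPrimeSplit n with p , p-prime , p∣n , p-rough ← leastPrimeFactor n
  with factorOut p {{prime⇒nonTrivial p-prime}} n {{nonTrivial⇒nonZero n}}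
... | zero  , m , n≡1*m , p∤m =
  contradiction (subst (p ∣_) (trans n≡1*m (+-identityʳ m)) p∣n) p∤m
... | suc a , m , n≡p^[1+a]*m , p∤m = record
  { p = p ; a = a ; m = m ; p-prime = p-prime ; p-rough = p-rough
  ; p∤m = p∤m ; n≡p^[1+a]*m = n≡p^[1+a]*m
  }

-- τ n is definitionally length (divisors n).
divisors : ℕ → List ℕ
divisors n = filter (_∣? n) (map suc (upTo n))

divisors-unique : ∀ n → Unique (divisors n)
divisors-unique n = Unique.filter⁺ (_∣? n) (Unique.map⁺ suc-injective (Unique.upTo⁺ n))

∈-divisors⁻ : ∀ {m n} → m ∈ divisors n → m ∣ n
∈-divisors⁻ {n = n} m∈ = proj₂ (∈-filter⁻ (_∣? n) {xs = map suc (upTo n)} m∈)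

∈-divisors⁺ : ∀ {m n} .{{_ : NonZero n}} → m ∣ n → m ∈ divisors n
∈-divisors⁺ {zero}  {n} 0∣n = contradiction (0∣⇒≡0 0∣n) (≢-nonZero⁻¹ n)
∈-divisors⁺ {suc m} {n} m∣n =
  ∈-filter⁺ (_∣? n) (∈-map⁺ suc (∈-upTo⁺ (∣⇒≤ m∣n))) m∣n

0<τ : ∀ n .{{_ : NonZero n}} → 0 < τ n
0<τ n = ∈-length (∈-divisors⁺ (1∣ n))

τ[p^n]≤1+n : ∀ {p} → Prime p → ∀ n → τ (p ^ n) ≤ suc n
τ[p^n]≤1+n {p} pr n = begin
  τ (p ^ n)       ≤⟨ injection⇒length-≤ id (divisors-unique (p ^ n)) (λ _ _ → id) ∈powers ⟩
  length powers   ≡⟨ length-map (p ^_) (upTo (suc n)) ⟩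
  length (upTo (suc n)) ≡⟨ length-upTo (suc n) ⟩
  suc n           ∎
  where
  open ≤-Reasoning
  powers = map (p ^_) (upTo (suc n))
  ∈powers : ∀ {m} → m ∈ divisors (p ^ n) → m ∈ powers
  ∈powers m∈ with i , i≤n , refl ← ∣p^n⇒≡p^i pr n (∈-divisors⁻ m∈) =
    ∈-map⁺ (p ^_) (∈-upTo⁺ (s≤s i≤n))

τ[m*n]≤τ[m]*τ[n] : ∀ m n .{{_ : NonZero m}} .{{_ : NonZero n}} → τ (m * n) ≤ τ m * τ n
τ[m*n]≤τ[m]*τ[n] m n = begin
  τ (m * n)      ≤⟨ injection⇒length-≤ split (divisors-unique (m * n)) split-injective split-∈ ⟩
  length pairs   ≡⟨ length-cartesianProduct (divisors m) (divisors n) ⟩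
  τ m * τ n      ∎
  where
  open ≤-Reasoning
  pairs = cartesianProduct (divisors m) (divisors n)
  g∣c : ∀ c → gcd c m ∣ c
  g∣c c = gcd[m,n]∣m c m
  split : ℕ → ℕ × ℕ
  split c = gcd c m , quotient (g∣c c)
  split-injective : ∀ {c c′} → c ∈ divisors (m * n) → c′ ∈ divisors (m * n) →
                    split c ≡ split c′ → c ≡ c′
  split-injective {c} {c′} _ _ eq = begin-equality
    c                           ≡⟨ m∣n⇒n≡quotient*m (g∣c c) ⟩
    quotient (g∣c c) * gcd c m   ≡⟨ cong₂ _*_ (cong proj₂ eq) (cong proj₁ eq) ⟩
    quotient (g∣c c′) * gcd c′ m ≡⟨ m∣n⇒n≡quotient*m (g∣c c′) ⟨
    c′                          ∎
  split-∈ : ∀ {c} → c ∈ divisors (m * n) → split c ∈ pairs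
  split-∈ {c} c∈ = ∈-cartesianProduct⁺ (∈-divisors⁺ (gcd[m,n]∣n c m)) (∈-divisors⁺ q∣n)
    where
    instance _ = ≢-nonZero (gcd[m,n]≢0 c m (inj₂ (≢-nonZero⁻¹ m)))
    q = quotient (g∣c c)
    c∣n*g : c ∣ n * gcd c m
    c∣n*g = subst (c ∣_) (sym (c*gcd[m,n]≡gcd[cm,cn] n c m))
              (gcd-greatest (n∣m*n n) (subst (c ∣_) (*-comm m n) (∈-divisors⁻ c∈)))
    q∣n : q ∣ n
    q∣n = *-cancelʳ-∣ (gcd c m) (subst (_∣ n * gcd c m) (m∣n⇒n≡quotient*m (g∣c c)) c∣n*g)

τ[d]*[1+b]≤τ[d*p^b] : ∀ {d p} .{{_ : NonZero d}} .{{_ : NonZero p}} → p ∤ d → ∀ b →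
                      τ d * suc b ≤ τ (d * p ^ b)
τ[d]*[1+b]≤τ[d*p^b] {d} {p} p∤d b = begin
  τ d * suc b                  ≡⟨ cong (τ d *_) (length-upTo (suc b)) ⟨
  τ d * length (upTo (suc b))  ≡⟨ length-cartesianProduct (divisors d) (upTo (suc b)) ⟨
  length pairs                 ≤⟨ injection⇒length-≤ join pairs-unique join-injective join-∈ ⟩
  τ (d * p ^ b)                ∎
  where
  open ≤-Reasoning
  instance
    _ = m^n≢0 p b
    _ = m*n≢0 d (p ^ b)
  pairs = cartesianProduct (divisors d) (upTo (suc b))
  pairs-unique : Unique pairs
  pairs-unique = Unique.cartesianProduct⁺ (divisors-unique d) (Unique.upTo⁺ (suc b))
  join : ℕ × ℕ → ℕ
  join (y , i) = y * p ^ i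
  p∤ : ∀ {y} → y ∈ divisors d → p ∤ y
  p∤ y∈ p∣y = p∤d (∣-trans p∣y (∈-divisors⁻ y∈))
  join-injective : ∀ {u v} → u ∈ pairs → v ∈ pairs → join u ≡ join v → u ≡ v
  join-injective {y , i} {y′ , j} u∈ v∈ eq
    with y≡y′ , i≡j ← *p^-injective i j (p∤ (proj₁ (∈-cartesianProduct⁻ _ _ u∈)))
                                        (p∤ (proj₁ (∈-cartesianProduct⁻ _ _ v∈))) eq
    = cong₂ _,_ y≡y′ i≡j
  join-∈ : ∀ {u} → u ∈ pairs → join u ∈ divisors (d * p ^ b)
  join-∈ {y , i} u∈ with y∈ , i∈ ← ∈-cartesianProduct⁻ (divisors d) (upTo (suc b)) u∈ =
    ∈-divisors⁺ (*-pres-∣ (∈-divisors⁻ {n = d} y∈) (^-monoʳ-∣ p (s≤s⁻¹ (∈-upTo⁻ i∈))))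

-- P stands for the product of c prime factors of n set aside rather than put into d; each is
-- at least the least prime factor of n (rough⇒q^c≤P) and has cost a factor k in τ[n]≤k^c*τ[d]^k².
record Candidate (k n : ℕ) : Set where
  field
    d c P            : ℕ
    c<k              : c < k
    d∣n              : d ∣ n
    d^k*P≤n          : d ^ k * P ≤ n
    rough⇒q^c≤P      : ∀ {q} → q Rough n → q ^ c ≤ P
    τ[n]≤k^c*τ[d]^k² : τ n ≤ k ^ c * τ d ^ (k * k)

candidate[1] : ∀ {k} → 0 < k → Candidate k 1
candidate[1] {k} 0<k = record
  { d = 1 ; c = 0 ; P = 1 ; c<k = 0<k ; d∣n = ∣-refl
  ; d^k*P≤n          = ≤-reflexive (trans (*-identityʳ (1 ^ k)) (^-zeroˡ k))
  ; rough⇒q^c≤P      = λ _ → ≤-refl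
  ; τ[n]≤k^c*τ[d]^k² = ≤-reflexive (sym (trans (+-identityʳ (1 ^ (k * k))) (^-zeroˡ (k * k))))
  }

module _ {k n} (2≤k : 2 ≤ k) .{{_ : NonZero n}} (S : LeastPrimeSplit n)
         (C : Candidate k (LeastPrimeSplit.m S)) where

  open LeastPrimeSplit S
  open Candidate C
  open ≤-Reasoning

  private
    e K : ℕ
    e = suc a
    K = k * k
    instance
      _ = m≢0
      _ = ∣⇒nonZero d∣n
      _ = >-nonZero (≤-trans (s≤s z≤n) 2≤k)

    p∤d : p ∤ d
    p∤d p∣d = p∤m (∣-trans p∣d d∣n)

    d*p^b∣n : ∀ {b} → b ≤ e → d * p ^ b ∣ n
    d*p^b∣n {b} b≤e = subst (d * p ^ b ∣_) (trans (*-comm m (p ^ e)) (sym n≡p^[1+a]*m))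
                        (*-pres-∣ d∣n (^-monoʳ-∣ p b≤e))

    p*[d^k*P]≤n : p * (d ^ k * P) ≤ n
    p*[d^k*P]≤n = begin
      p * (d ^ k * P)  ≤⟨ *-mono-≤ (m≤m*n p (p ^ a) {{m^n≢0 p a}}) d^k*P≤n ⟩
      p ^ e * m        ≡⟨ n≡p^[1+a]*m ⟨
      n                ∎

    rough⇒rough-m : ∀ {q} → q Rough n → q Rough m
    rough⇒rough-m q-rough = rough∧∣⇒rough q-rough m∣n

    τ[n]≤[1+e]*k^c*τ[d]^K : τ n ≤ suc e * (k ^ c * τ d ^ K)
    τ[n]≤[1+e]*k^c*τ[d]^K = begin
      τ n                        ≡⟨ cong τ n≡p^[1+a]*m ⟩
      τ (p ^ e * m)              ≤⟨ τ[m*n]≤τ[m]*τ[n] (p ^ e) m {{m^n≢0 p e}} ⟩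
      τ (p ^ e) * τ m            ≤⟨ *-mono-≤ (τ[p^n]≤1+n p-prime e) τ[n]≤k^c*τ[d]^k² ⟩
      suc e * (k ^ c * τ d ^ K)  ∎

    τ[n]≤k^[1+c]*τ[d]^K : e < k → τ n ≤ k ^ suc c * τ d ^ K
    τ[n]≤k^[1+c]*τ[d]^K e<k = begin
      τ n                        ≤⟨ τ[n]≤[1+e]*k^c*τ[d]^K ⟩
      suc e * (k ^ c * τ d ^ K)  ≤⟨ *-monoˡ-≤ (k ^ c * τ d ^ K) e<k ⟩
      k * (k ^ c * τ d ^ K)      ≡⟨ *-assoc k (k ^ c) (τ d ^ K) ⟨
      k ^ suc c * τ d ^ K        ∎

    τ[d]*[1+b]⇒τ[d*p^b] : ∀ b x → τ n ≤ x * (τ d * suc b) ^ K → τ n ≤ x * τ (d * p ^ b) ^ K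
    τ[d]*[1+b]⇒τ[d*p^b] b x τ[n]≤ =
      ≤-trans τ[n]≤ (*-monoʳ-≤ x (^-monoˡ-≤ K (τ[d]*[1+b]≤τ[d*p^b] p∤d b)))

  absorbPower : k ≤ e → Candidate k n
  absorbPower k≤e = record
    { d = d * p ^ b ; c = c ; P = P ; c<k = c<k ; d∣n = d*p^b∣n b≤e
    ; d^k*P≤n = d′^k*P≤n
    ; rough⇒q^c≤P = rough⇒q^c≤P ∘ rough⇒rough-m
    ; τ[n]≤k^c*τ[d]^k² = τ[d]*[1+b]⇒τ[d*p^b] b (k ^ c) τ-bound
    }
    where
    b = e / k
    bk≤e : b * k ≤ e
    bk≤e = m/n*n≤m e k
    b≤e : b ≤ e
    b≤e = ≤-trans (m≤m*n b k) bk≤e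
    d′^k*P≤n : (d * p ^ b) ^ k * P ≤ n
    d′^k*P≤n = begin
      (d * p ^ b) ^ k * P        ≡⟨ cong (_* P) (^-distribʳ-* d (p ^ b) k) ⟩
      d ^ k * (p ^ b) ^ k * P    ≡⟨ cong (λ x → d ^ k * x * P) (^-*-assoc p b k) ⟩
      d ^ k * p ^ (b * k) * P    ≡⟨ xy∙z≈xz∙y (d ^ k) (p ^ (b * k)) P ⟩
      d ^ k * P * p ^ (b * k)    ≤⟨ *-mono-≤ d^k*P≤n (^-monoʳ-≤ p bk≤e) ⟩
      m * p ^ e                  ≡⟨ *-comm m (p ^ e) ⟩
      p ^ e * m                  ≡⟨ n≡p^[1+a]*m ⟨
      n                          ∎
    τ-bound : τ n ≤ k ^ c * (τ d * suc b) ^ K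
    τ-bound = begin
      τ n                              ≤⟨ τ[n]≤[1+e]*k^c*τ[d]^K ⟩
      suc e * (k ^ c * τ d ^ K)        ≤⟨ *-monoˡ-≤ (k ^ c * τ d ^ K) 1+e≤[1+b]^K ⟩
      suc b ^ K * (k ^ c * τ d ^ K)    ≡⟨ x∙yz≈y∙zx (suc b ^ K) (k ^ c) (τ d ^ K) ⟩
      k ^ c * (τ d ^ K * suc b ^ K)    ≡⟨ cong (k ^ c *_) (^-distribʳ-* (τ d) (suc b) K) ⟨
      k ^ c * (τ d * suc b) ^ K        ∎
      where
      1+e≤[1+b]^K : suc e ≤ suc b ^ K
      1+e≤[1+b]^K = begin
        suc e       ≤⟨ suc[m]≤suc[m/n]*n e k ⟩
        suc b * k   ≡⟨ *-comm (suc b) k ⟩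
        k * suc b   ≤⟨ m*n≤n^[m*m] 2≤k (s≤s (m≥n⇒m/n>0 k≤e)) ⟩
        suc b ^ K   ∎

  setAside : e < k → suc c < k → Candidate k n
  setAside e<k 1+c<k = record
    { d = d ; c = suc c ; P = p * P ; c<k = 1+c<k ; d∣n = ∣-trans d∣n m∣n
    ; d^k*P≤n = ≤-trans (≤-reflexive (x∙yz≈y∙xz (d ^ k) p P)) p*[d^k*P]≤n
    ; rough⇒q^c≤P = λ q-rough →
        *-mono-≤ (rough⇒≤ (rough∧∣⇒rough q-rough p∣n)) (rough⇒q^c≤P (rough⇒rough-m q-rough))
    ; τ[n]≤k^c*τ[d]^k² = τ[n]≤k^[1+c]*τ[d]^K e<k
    }

  absorbPrime : e < k → suc c ≡ k → Candidate k n
  absorbPrime e<k 1+c≡k = record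
    { d = d * p ^ 1 ; c = 0 ; P = 1 ; c<k = ≤-trans (s≤s z≤n) 2≤k ; d∣n = d*p^b∣n (s≤s z≤n)
    ; d^k*P≤n = d′^k*1≤n
    ; rough⇒q^c≤P = λ _ → ≤-refl
    ; τ[n]≤k^c*τ[d]^k² = τ[d]*[1+b]⇒τ[d*p^b] 1 1 τ-bound
    }
    where
    p^c≤P : p ^ c ≤ P
    p^c≤P = rough⇒q^c≤P (rough⇒rough-m p-rough)
    d′^k*1≤n : (d * p ^ 1) ^ k * 1 ≤ n
    d′^k*1≤n = begin
      (d * p ^ 1) ^ k * 1  ≡⟨ *-identityʳ _ ⟩
      (d * p ^ 1) ^ k      ≡⟨ ^-distribʳ-* d (p ^ 1) k ⟩
      d ^ k * (p ^ 1) ^ k  ≡⟨ cong (d ^ k *_) (trans (^-*-assoc p 1 k) (cong (p ^_) (*-identityˡ k))) ⟩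
      d ^ k * p ^ k        ≡⟨ cong (λ i → d ^ k * p ^ i) 1+c≡k ⟨
      d ^ k * (p * p ^ c)  ≤⟨ *-monoʳ-≤ (d ^ k) (*-monoʳ-≤ p p^c≤P) ⟩
      d ^ k * (p * P)      ≡⟨ x∙yz≈y∙xz (d ^ k) p P ⟩
      p * (d ^ k * P)      ≤⟨ p*[d^k*P]≤n ⟩
      n                    ∎
    τ-bound : τ n ≤ 1 * (τ d * 2) ^ K
    τ-bound = begin
      τ n                  ≤⟨ τ[n]≤k^[1+c]*τ[d]^K e<k ⟩
      k ^ suc c * τ d ^ K  ≡⟨ cong (λ i → k ^ i * τ d ^ K) 1+c≡k ⟩
      k ^ k * τ d ^ K      ≤⟨ *-monoˡ-≤ (τ d ^ K) (n^n≤2^[n*n] k) ⟩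
      2 ^ K * τ d ^ K      ≡⟨ ^-distribʳ-* 2 (τ d) K ⟨
      (2 * τ d) ^ K        ≡⟨ cong (_^ K) (*-comm 2 (τ d)) ⟩
      (τ d * 2) ^ K        ≡⟨ *-identityˡ _ ⟨
      1 * (τ d * 2) ^ K    ∎

  extend : Candidate k n
  extend with k ≤? e
  ... | yes k≤e = absorbPower k≤e
  ... | no  k≰e with m≤n⇒m<n∨m≡n c<k
  ...   | inj₁ 1+c<k = setAside (≰⇒> k≰e) 1+c<k
  ...   | inj₂ 1+c≡k = absorbPrime (≰⇒> k≰e) 1+c≡k

candidate : ∀ {k} → 2 ≤ k → ∀ n .{{_ : NonZero n}} → Candidate k n
candidate {k} 2≤k = <-rec _ candidate′
  where
  Goal : ℕ → Set
  Goal n = .{{NonZero n}} → Candidate k n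
  candidate′ : ∀ n → (∀ {m} → m < n → Goal m) → Goal n
  candidate′ 1        _   = candidate[1] (≤-trans (s≤s z≤n) 2≤k)
  candidate′ n@(2+ _) rec = extend 2≤k S (rec m<n {{m≢0}})
    where
    S = leastPrimeSplit n
    open LeastPrimeSplit S

lemma6 : (n k : ℕ) → 1 ≤ n → 2 ≤ k →
    ∃[ d ] (d ∣ n × d ^ k ≤ n × τ n ≤ 2 ^ (k * k) * τ d ^ (k * k * k))
lemma6 n k 1≤n 2≤k = d , d∣n , d^k≤n , τ[n]≤2^k²*τ[d]^k³
  where
  instance
    _ = >-nonZero 1≤n
    _ = >-nonZero (≤-trans (s≤s z≤n) 2≤k)
  open Candidate (candidate 2≤k n)
  1≤P : 1 ≤ P
  1≤P = subst (_≤ P) (^-zeroˡ c) (rough⇒q^c≤P 1-rough)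
  instance
    _ = >-nonZero 1≤P
    _ = >-nonZero (0<τ d {{∣⇒nonZero d∣n}})
  open ≤-Reasoning
  d^k≤n : d ^ k ≤ n
  d^k≤n = ≤-trans (m≤m*n (d ^ k) P) d^k*P≤n
  τ[n]≤2^k²*τ[d]^k³ : τ n ≤ 2 ^ (k * k) * τ d ^ (k * k * k)
  τ[n]≤2^k²*τ[d]^k³ = begin
    τ n                              ≤⟨ τ[n]≤k^c*τ[d]^k² ⟩
    k ^ c * τ d ^ (k * k)            ≤⟨ *-mono-≤ k^c≤2^k² (^-monoʳ-≤ (τ d) (m≤m*n (k * k) k)) ⟩
    2 ^ (k * k) * τ d ^ (k * k * k)  ∎
    where
    k^c≤2^k² : k ^ c ≤ 2 ^ (k * k)
    k^c≤2^k² = ≤-trans (^-monoʳ-≤ k (<⇒≤ c<k)) (n^n≤2^[n*n] k)
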